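{- For all integers $n,j\ge0$, \[4^n\sum_{i=j}^n\binom{2i}{i}\binom{i}{j}\frac1{4^i}=\frac{2n+1}{2j+1}\binom{n}{j}\binom{2n}{n}.\] -}

module Defs where

open import Data.Nat as ℕ using (ℕ; suc; _^_; _∸_)
open import Data.Nat.Properties using (m^n≢0)
open import Data.Integer using (+_)
open import Data.Rational using (ℚ; _/_; _+_; 0ℚ)
open import Data.List using (List; map; upTo; foldr)

inv4^ : ℕ → ℚ
inv4^ i = (+ 1) / (4 ^ i)
  where instance _ = m^n≢0 4 i

-- the integers j, j+1, ..., n  (empty when j > n)
range : ℕ → ℕ → List ℕ
range j n = map (j ℕ.+_) (upTo (suc n ∸ j))

sumFromTo : ℕ → ℕ → (ℕ → ℚ) → ℚ
sumFromTo j n f = foldr (λ i acc → f i + acc) 0ℚ (range j n)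

-- Clearing denominators turns the left-hand side into the natural number S n with
-- S (n+1) = 4 S n + C(2n+2,n+1) C(n+1,j).  The right-hand side satisfies the same recurrence:
-- multiplied by n+1, this follows from the absorption identity (k+1) C(n+1,k+1) = (n+1) C(n,k),
-- which yields (n+1) C(2n+2,n+1) = 2(2n+1) C(2n,n) and (n+1) C(n+1,j) = (n+1) C(n,j) + j C(n+1,j).
module Submission where

open import Data.Nat as ℕ using (ℕ; zero; suc; _^_; _≤?_)
open import Data.Nat.Combinatorics using (_C_)
open import Data.List.Base using (_∷_; [])
open import Data.Nat.Tactic.RingSolver using (solve)
open import Function.Base using (_∘_)
open import Relation.Binary.PropositionalEquality using (_≡_; refl; sym; trans; cong; cong₂; subst; module ≡-Reasoning)
open ≡-Reasoning

open import Defs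

module Binomial where

  open import Data.Nat.Base using (_+_; _*_; _<_; s≤s; z≤n)
  open import Data.Nat.Combinatorics using (nCk+nC[k+1]≡[n+1]C[k+1]; nCk≡nC[n∸k]; k>n⇒nCk≡0; nC1≡n)
  open import Data.Nat.Properties

  [k+1]*[n+1]C[k+1]≡[n+1]*nCk : ∀ n k → suc k * (suc n C suc k) ≡ suc n * (n C k)
  [k+1]*[n+1]C[k+1]≡[n+1]*nCk zero    zero    = refl
  [k+1]*[n+1]C[k+1]≡[n+1]*nCk zero    (suc k) =
    trans (cong (suc (suc k) *_) (k>n⇒nCk≡0 {1} {suc (suc k)} (s≤s (s≤s z≤n)))) (*-zeroʳ (suc (suc k)))
  [k+1]*[n+1]C[k+1]≡[n+1]*nCk (suc n) zero    =
    trans (*-identityˡ (suc (suc n) C 1)) (trans (nC1≡n (suc (suc n))) (sym (*-identityʳ (suc (suc n)))))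
  [k+1]*[n+1]C[k+1]≡[n+1]*nCk (suc n) (suc k) = begin
    suc (suc k) * (suc (suc n) C suc (suc k))
      ≡⟨ cong (suc (suc k) *_) (sym (nCk+nC[k+1]≡[n+1]C[k+1] (suc n) (suc k))) ⟩
    suc (suc k) * (suc n C suc k + suc n C suc (suc k))
      ≡⟨ *-distribˡ-+ (suc (suc k)) x (suc n C suc (suc k)) ⟩
    (x + suc k * x) + suc (suc k) * (suc n C suc (suc k))
      ≡⟨ cong₂ (λ u v → (x + u) + v) ([k+1]*[n+1]C[k+1]≡[n+1]*nCk n k)
                                    ([k+1]*[n+1]C[k+1]≡[n+1]*nCk n (suc k)) ⟩
    (x + suc n * (n C k)) + suc n * (n C suc k)
      ≡⟨ +-assoc x _ _ ⟩
    x + (suc n * (n C k) + suc n * (n C suc k))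
      ≡⟨ cong (x +_) (sym (*-distribˡ-+ (suc n) (n C k) (n C suc k))) ⟩
    x + suc n * (n C k + n C suc k)
      ≡⟨ cong (λ u → x + suc n * u) (nCk+nC[k+1]≡[n+1]C[k+1] n k) ⟩
    x + suc n * x ∎
    where x = suc n C suc k

  [m+n]Cm≡[m+n]Cn : ∀ m n → (m + n) C m ≡ (m + n) C n
  [m+n]Cm≡[m+n]Cn m n = trans (nCk≡nC[n∸k] (m≤m+n m n)) (cong ((m + n) C_) (m+n∸m≡n m n))

  [n+1]*[n+1]Cj≡[n+1]*nCj+j*[n+1]Cj : ∀ n j → suc n * (suc n C j) ≡ suc n * (n C j) + j * (suc n C j)
  [n+1]*[n+1]Cj≡[n+1]*nCj+j*[n+1]Cj n zero    = sym (+-identityʳ (suc n * 1))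
  [n+1]*[n+1]Cj≡[n+1]*nCj+j*[n+1]Cj n (suc k) = begin
    suc n * (suc n C suc k)
      ≡⟨ cong (suc n *_) (sym (nCk+nC[k+1]≡[n+1]C[k+1] n k)) ⟩
    suc n * (n C k + n C suc k)
      ≡⟨ *-distribˡ-+ (suc n) (n C k) (n C suc k) ⟩
    suc n * (n C k) + suc n * (n C suc k)
      ≡⟨ +-comm (suc n * (n C k)) _ ⟩
    suc n * (n C suc k) + suc n * (n C k)
      ≡⟨ cong (suc n * (n C suc k) +_) (sym ([k+1]*[n+1]C[k+1]≡[n+1]*nCk n k)) ⟩
    suc n * (n C suc k) + suc k * (suc n C suc k) ∎

  [n+1]*[2n+2]C[n+1]≡2*[2n+1]*[2n]Cn : ∀ n → suc n * ((2 * suc n) C suc n) ≡ 2 * ((2 * n + 1) * ((2 * n) C n))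
  [n+1]*[2n+2]C[n+1]≡2*[2n+1]*[2n]Cn n = begin
    suc n * ((2 * suc n) C suc n)
      ≡⟨ cong (λ m → suc n * (m C suc n)) 2[n+1]≡[2n+1]+1 ⟩
    suc n * (suc (suc (2 * n)) C suc n)
      ≡⟨ [k+1]*[n+1]C[k+1]≡[n+1]*nCk (suc (2 * n)) n ⟩
    suc (suc (2 * n)) * (suc (2 * n) C n)
      ≡⟨ cong (suc (suc (2 * n)) *_) [2n+1]Cn≡[2n+1]C[n+1] ⟩
    suc (suc (2 * n)) * (suc (2 * n) C suc n)
      ≡⟨ cong (_* (suc (2 * n) C suc n)) (sym 2[n+1]≡[2n+1]+1) ⟩
    2 * suc n * (suc (2 * n) C suc n)
      ≡⟨ *-assoc 2 (suc n) _ ⟩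
    2 * (suc n * (suc (2 * n) C suc n))
      ≡⟨ cong (2 *_) ([k+1]*[n+1]C[k+1]≡[n+1]*nCk (2 * n) n) ⟩
    2 * (suc (2 * n) * ((2 * n) C n))
      ≡⟨ cong (λ m → 2 * (m * ((2 * n) C n))) (+-comm 1 (2 * n)) ⟩
    2 * ((2 * n + 1) * ((2 * n) C n)) ∎
    where
    2[n+1]≡[2n+1]+1 : 2 * suc n ≡ suc (suc (2 * n))
    2[n+1]≡[2n+1]+1 = solve (n ∷ [])
    n+[n+1]≡2n+1 : n + suc n ≡ suc (2 * n)
    n+[n+1]≡2n+1 = solve (n ∷ [])
    [2n+1]Cn≡[2n+1]C[n+1] : suc (2 * n) C n ≡ suc (2 * n) C suc n
    [2n+1]Cn≡[2n+1]C[n+1] = subst (λ m → m C n ≡ m C suc n) n+[n+1]≡2n+1 ([m+n]Cm≡[m+n]Cn n (suc n))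

  -- scaledSum n j = Σ_{i ≤ n} 4^(n-i) C(2i,i) C(i,j)
  scaledSum : ℕ → ℕ → ℕ
  scaledSum zero    j = 0 C j
  scaledSum (suc n) j = 4 * scaledSum n j + ((2 * suc n) C suc n) * (suc n C j)

  scaledSum-vanishes : ∀ {n j} → n < j → scaledSum n j ≡ 0
  scaledSum-vanishes {zero}  {j} n<j = k>n⇒nCk≡0 n<j
  scaledSum-vanishes {suc n} {j} n<j = begin
    4 * scaledSum n j + ((2 * suc n) C suc n) * (suc n C j)
      ≡⟨ cong₂ (λ u v → 4 * u + ((2 * suc n) C suc n) * v)
               (scaledSum-vanishes (≤-trans (n≤1+n (suc n)) n<j)) (k>n⇒nCk≡0 n<j) ⟩
    4 * 0 + ((2 * suc n) C suc n) * 0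
      ≡⟨ *-zeroʳ ((2 * suc n) C suc n) ⟩
    0 ∎

  closedForm-step : ∀ n j s x y z c →
                    suc (2 * j) * s ≡ (2 * n + 1) * (x * c) →
                    suc n * z ≡ 2 * ((2 * n + 1) * c) →
                    suc n * y ≡ suc n * x + j * y →
                    suc n * (suc (2 * j) * (4 * s + z * y)) ≡ suc n * ((2 * suc n + 1) * (y * z))
  closedForm-step n j s x y z c ih central column = begin
    suc n * (suc (2 * j) * (4 * s + z * y))
      ≡⟨ solve (n ∷ j ∷ s ∷ y ∷ z ∷ []) ⟩
    4 * suc n * (suc (2 * j) * s) + suc (2 * j) * y * (suc n * z)
      ≡⟨ cong₂ (λ u v → 4 * suc n * u + suc (2 * j) * y * v) ih central ⟩
    4 * suc n * ((2 * n + 1) * (x * c)) + suc (2 * j) * y * (2 * ((2 * n + 1) * c))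
      ≡⟨ solve (n ∷ j ∷ x ∷ y ∷ c ∷ []) ⟩
    2 * ((2 * n + 1) * c) * (2 * (suc n * x + j * y) + y)
      ≡⟨ cong (λ u → 2 * ((2 * n + 1) * c) * (2 * u + y)) (sym column) ⟩
    2 * ((2 * n + 1) * c) * (2 * (suc n * y) + y)
      ≡⟨ solve (n ∷ y ∷ c ∷ []) ⟩
    (2 * suc n + 1) * y * (2 * ((2 * n + 1) * c))
      ≡⟨ cong ((2 * suc n + 1) * y *_) (sym central) ⟩
    (2 * suc n + 1) * y * (suc n * z)
      ≡⟨ solve (n ∷ y ∷ z ∷ []) ⟩
    suc n * ((2 * suc n + 1) * (y * z)) ∎

  scaledSum-closedForm : ∀ n j → suc (2 * j) * scaledSum n j ≡ (2 * n + 1) * ((n C j) * ((2 * n) C n))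
  scaledSum-closedForm zero    zero    = refl
  scaledSum-closedForm zero    (suc j) = *-zeroʳ (suc (2 * suc j))
  scaledSum-closedForm (suc n) j = *-cancelˡ-≡ _ _ (suc n)
    (closedForm-step n j (scaledSum n j) (n C j) (suc n C j) ((2 * suc n) C suc n) ((2 * n) C n)
      (scaledSum-closedForm n j)
      ([n+1]*[2n+2]C[n+1]≡2*[2n+1]*[2n]Cn n)
      ([n+1]*[n+1]Cj≡[n+1]*nCj+j*[n+1]Cj n j))

open Binomial

open import Data.Integer.Base as ℤ using (+_)
open import Data.Integer.Properties using (pos-*; pos-+) renaming (*-identityʳ to ℤ-*-identityʳ)
open import Data.List.Base using ([_]; _++_; _∷ʳ_; map; upTo; foldr)
open import Data.List.Properties using (foldr-++; foldr-fusion; map-++; upTo-∷ʳ)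
open import Data.Nat.Properties using (+-∸-assoc; m+[n∸m]≡n; m≤n⇒m∸n≡0; ≰⇒>; m^n≢0)
open import Data.Rational using (ℚ; _/_; _*_; _+_; 0ℚ; 1ℚ; toℚᵘ)
open import Data.Rational.Properties using (toℚᵘ-injective; toℚᵘ-fromℚᵘ; fromℚᵘ-cong; toℚᵘ-homo-*; toℚᵘ-homo-+; +-identityˡ; +-identityʳ; +-assoc; *-assoc; *-identityʳ; *-zeroʳ; *-distribˡ-+; +-*-commutativeRing)
open import Data.Rational.Unnormalised.Base using (mkℚᵘ; *≡*)
import Data.Rational.Unnormalised.Properties as ℚᵘ
open import Algebra.Bundles using (CommutativeRing)
open import Algebra.Properties.CommutativeSemigroup (CommutativeRing.*-commutativeSemigroup +-*-commutativeRing) using (x∙yz≈y∙xz)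
open import Relation.Nullary using (yes; no)

fromℕ : ℕ → ℚ
fromℕ n = + n / 1

a*d≡c*b⇒a/b≡c/d : ∀ a b c d → a ℕ.* suc d ≡ c ℕ.* suc b → + a / suc b ≡ + c / suc d
a*d≡c*b⇒a/b≡c/d a b c d eq = fromℚᵘ-cong {mkℚᵘ (+ a) b} {mkℚᵘ (+ c) d}
  (*≡* (trans (sym (pos-* a (suc d))) (trans (cong +_ eq) (pos-* c (suc b)))))

[a/b]*[c/d]≡[a*c]/[b*d] : ∀ a b c d → (+ a / suc b) * (+ c / suc d) ≡ + (a ℕ.* c) / (suc b ℕ.* suc d)
[a/b]*[c/d]≡[a*c]/[b*d] a b c d = toℚᵘ-injective
  (ℚᵘ.≃-trans (toℚᵘ-homo-* (+ a / suc b) (+ c / suc d))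
  (ℚᵘ.≃-trans (ℚᵘ.*-cong (toℚᵘ-fromℚᵘ (mkℚᵘ (+ a) b)) (toℚᵘ-fromℚᵘ (mkℚᵘ (+ c) d)))
  (ℚᵘ.≃-trans (*≡* (cong (ℤ._* + (suc b ℕ.* suc d)) (sym (pos-* a c))))
  (ℚᵘ.≃-sym (toℚᵘ-fromℚᵘ (mkℚᵘ (+ (a ℕ.* c)) (d ℕ.+ b ℕ.* suc d)))))))

fromℕ-homo-* : ∀ m n → fromℕ (m ℕ.* n) ≡ fromℕ m * fromℕ n
fromℕ-homo-* m n = sym ([a/b]*[c/d]≡[a*c]/[b*d] m 0 n 0)

fromℕ-homo-+ : ∀ m n → fromℕ (m ℕ.+ n) ≡ fromℕ m + fromℕ n
fromℕ-homo-+ m n = toℚᵘ-injective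
  (ℚᵘ.≃-trans (toℚᵘ-fromℚᵘ (mkℚᵘ (+ (m ℕ.+ n)) 0))
  (ℚᵘ.≃-trans (*≡* (cong (ℤ._* + 1) (trans (pos-+ m n) (sym (cong₂ ℤ._+_ (ℤ-*-identityʳ (+ m)) (ℤ-*-identityʳ (+ n)))))))
  (ℚᵘ.≃-sym (ℚᵘ.≃-trans (toℚᵘ-homo-+ (fromℕ m) (fromℕ n))
    (ℚᵘ.+-cong (toℚᵘ-fromℚᵘ (mkℚᵘ (+ m) 0)) (toℚᵘ-fromℚᵘ (mkℚᵘ (+ n) 0)))))))

fromℕ-*-inverse : ∀ m .{{_ : ℕ.NonZero m}} → fromℕ m * (+ 1 / m) ≡ 1ℚ
fromℕ-*-inverse (suc m) = trans ([a/b]*[c/d]≡[a*c]/[b*d] (suc m) 0 1 m)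
  (a*d≡c*b⇒a/b≡c/d (suc m ℕ.* 1) (ℕ.pred (1 ℕ.* suc m)) 1 0 cross)
  where
  cross : suc m ℕ.* 1 ℕ.* 1 ≡ 1 ℕ.* (1 ℕ.* suc m)
  cross = solve (m ∷ [])

[1+d]*t≡a*b⇒t≡a/[1+d]*b : ∀ t a d b → suc d ℕ.* t ≡ a ℕ.* b → fromℕ t ≡ (+ a / suc d) * fromℕ b
[1+d]*t≡a*b⇒t≡a/[1+d]*b t a d b eq = begin
  + t / 1                     ≡⟨ a*d≡c*b⇒a/b≡c/d t 0 (a ℕ.* b) (d ℕ.* 1) cross ⟩
  + (a ℕ.* b) / suc (d ℕ.* 1) ≡⟨ [a/b]*[c/d]≡[a*c]/[b*d] a d b 0 ⟨
  (+ a / suc d) * fromℕ b     ∎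
  where
  cross : t ℕ.* suc (d ℕ.* 1) ≡ a ℕ.* b ℕ.* 1
  cross = begin
    t ℕ.* suc (d ℕ.* 1) ≡⟨ solve (t ∷ d ∷ []) ⟩
    suc d ℕ.* t         ≡⟨ eq ⟩
    a ℕ.* b             ≡⟨ solve (a ∷ b ∷ []) ⟩
    a ℕ.* b ℕ.* 1       ∎

range-∷ʳ : ∀ {j n} → j ℕ.≤ suc n → range j (suc n) ≡ range j n ∷ʳ suc n
range-∷ʳ {j} {n} j≤1+n = begin
  map (j ℕ.+_) (upTo (suc (suc n) ℕ.∸ j)) ≡⟨ cong (map (j ℕ.+_) ∘ upTo) (+-∸-assoc 1 j≤1+n) ⟩
  map (j ℕ.+_) (upTo (suc k))             ≡⟨ cong (map (j ℕ.+_)) (upTo-∷ʳ k) ⟨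
  map (j ℕ.+_) (upTo k ∷ʳ k)              ≡⟨ map-++ (j ℕ.+_) (upTo k) [ k ] ⟩
  range j n ∷ʳ (j ℕ.+ k)                  ≡⟨ cong (range j n ∷ʳ_) (m+[n∸m]≡n j≤1+n) ⟩
  range j n ∷ʳ suc n                      ∎
  where k = suc n ℕ.∸ j

foldr-+-∷ʳ : ∀ (f : ℕ → ℚ) xs x → foldr (λ i acc → f i + acc) 0ℚ (xs ∷ʳ x) ≡ foldr (λ i acc → f i + acc) 0ℚ xs + f x
foldr-+-∷ʳ f xs x = begin
  foldr g 0ℚ (xs ++ [ x ]) ≡⟨ foldr-++ g 0ℚ xs [ x ] ⟩
  foldr g (f x + 0ℚ) xs    ≡⟨ cong (λ e → foldr g e xs) (trans (+-identityʳ (f x)) (sym (+-identityˡ (f x)))) ⟩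
  foldr g (0ℚ + f x) xs    ≡⟨ foldr-fusion (_+ f x) 0ℚ (λ i acc → +-assoc (f i) acc (f x)) xs ⟨
  foldr g 0ℚ xs + f x      ∎
  where g = λ i acc → f i + acc

sumFromTo-empty : ∀ {j n} f → n ℕ.< j → sumFromTo j n f ≡ 0ℚ
sumFromTo-empty {j} f n<j = cong (λ k → foldr (λ i acc → f i + acc) 0ℚ (map (j ℕ.+_) (upTo k))) (m≤n⇒m∸n≡0 n<j)

sumFromTo-∷ʳ : ∀ {j n} f → j ℕ.≤ suc n → sumFromTo j (suc n) f ≡ sumFromTo j n f + f (suc n)
sumFromTo-∷ʳ {j} {n} f j≤1+n =
  trans (cong (foldr (λ i acc → f i + acc) 0ℚ) (range-∷ʳ j≤1+n)) (foldr-+-∷ʳ f (range j n) (suc n))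

summand : ℕ → ℕ → ℚ
summand j i = fromℕ ((2 ℕ.* i) C i) * (fromℕ (i C j) * inv4^ i)

fromℕ[4^i]*summand≡fromℕ[C*C] : ∀ j i → fromℕ (4 ^ i) * summand j i ≡ fromℕ (((2 ℕ.* i) C i) ℕ.* (i C j))
fromℕ[4^i]*summand≡fromℕ[C*C] j i = begin
  x * (a * (b * inv4^ i))   ≡⟨ cong (x *_) (sym (*-assoc a b (inv4^ i))) ⟩
  x * ((a * b) * inv4^ i)   ≡⟨ x∙yz≈y∙xz x (a * b) (inv4^ i) ⟩
  (a * b) * (x * inv4^ i)   ≡⟨ cong₂ _*_ (sym (fromℕ-homo-* ((2 ℕ.* i) C i) (i C j))) (fromℕ-*-inverse (4 ^ i) {{m^n≢0 4 i}}) ⟩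
  fromℕ (((2 ℕ.* i) C i) ℕ.* (i C j)) * 1ℚ ≡⟨ *-identityʳ _ ⟩
  fromℕ (((2 ℕ.* i) C i) ℕ.* (i C j)) ∎
  where
  x = fromℕ (4 ^ i)
  a = fromℕ ((2 ℕ.* i) C i)
  b = fromℕ (i C j)

4^n*sum≡scaledSum : ∀ n j → fromℕ (4 ^ n) * sumFromTo j n (summand j) ≡ fromℕ (scaledSum n j)
4^n*sum≡scaledSum zero    zero    = refl
4^n*sum≡scaledSum zero    (suc j) = cong (fromℕ 1 *_) (sumFromTo-empty {suc j} (summand (suc j)) (ℕ.s≤s ℕ.z≤n))
4^n*sum≡scaledSum (suc n) j with j ≤? suc n
... | no j≰1+n = begin
  fromℕ (4 ^ suc n) * sumFromTo j (suc n) (summand j) ≡⟨ cong (fromℕ (4 ^ suc n) *_) (sumFromTo-empty (summand j) (≰⇒> j≰1+n)) ⟩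
  fromℕ (4 ^ suc n) * 0ℚ                              ≡⟨ *-zeroʳ (fromℕ (4 ^ suc n)) ⟩
  fromℕ 0                                             ≡⟨ cong fromℕ (scaledSum-vanishes (≰⇒> j≰1+n)) ⟨
  fromℕ (scaledSum (suc n) j)                         ∎
... | yes j≤1+n = begin
  fromℕ (4 ^ suc n) * sumFromTo j (suc n) (summand j)
    ≡⟨ cong (fromℕ (4 ^ suc n) *_) (sumFromTo-∷ʳ (summand j) j≤1+n) ⟩
  fromℕ (4 ^ suc n) * (sumFromTo j n (summand j) + summand j (suc n))
    ≡⟨ *-distribˡ-+ (fromℕ (4 ^ suc n)) _ _ ⟩
  fromℕ (4 ^ suc n) * sumFromTo j n (summand j) + fromℕ (4 ^ suc n) * summand j (suc n)
    ≡⟨ cong₂ _+_ prefix (fromℕ[4^i]*summand≡fromℕ[C*C] j (suc n)) ⟩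
  fromℕ (4 ℕ.* scaledSum n j) + fromℕ (((2 ℕ.* suc n) C suc n) ℕ.* (suc n C j))
    ≡⟨ fromℕ-homo-+ (4 ℕ.* scaledSum n j) _ ⟨
  fromℕ (scaledSum (suc n) j) ∎
  where
  prefix : fromℕ (4 ^ suc n) * sumFromTo j n (summand j) ≡ fromℕ (4 ℕ.* scaledSum n j)
  prefix = begin
    fromℕ (4 ^ suc n) * sumFromTo j n (summand j)
      ≡⟨ cong (_* sumFromTo j n (summand j)) (fromℕ-homo-* 4 (4 ^ n)) ⟩
    fromℕ 4 * fromℕ (4 ^ n) * sumFromTo j n (summand j)
      ≡⟨ *-assoc (fromℕ 4) (fromℕ (4 ^ n)) _ ⟩
    fromℕ 4 * (fromℕ (4 ^ n) * sumFromTo j n (summand j))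
      ≡⟨ cong (fromℕ 4 *_) (4^n*sum≡scaledSum n j) ⟩
    fromℕ 4 * fromℕ (scaledSum n j)
      ≡⟨ fromℕ-homo-* 4 (scaledSum n j) ⟨
    fromℕ (4 ℕ.* scaledSum n j) ∎

lemma7p8 : (n j : ℕ) → ((+ (4 ^ n)) / 1) * sumFromTo j n (λ i → ((+ ((2 ℕ.* i) C i)) / 1) * (((+ (i C j)) / 1) * inv4^ i)) ≡ ((+ (2 ℕ.* n ℕ.+ 1)) / suc (2 ℕ.* j)) * (((+ (n C j)) / 1) * ((+ ((2 ℕ.* n) C n)) / 1))
lemma7p8 n j = begin
  fromℕ (4 ^ n) * sumFromTo j n (summand j)
    ≡⟨ 4^n*sum≡scaledSum n j ⟩
  fromℕ (scaledSum n j)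
    ≡⟨ [1+d]*t≡a*b⇒t≡a/[1+d]*b (scaledSum n j) (2 ℕ.* n ℕ.+ 1) (2 ℕ.* j) _ (scaledSum-closedForm n j) ⟩
  (+ (2 ℕ.* n ℕ.+ 1) / suc (2 ℕ.* j)) * fromℕ ((n C j) ℕ.* ((2 ℕ.* n) C n))
    ≡⟨ cong (+ (2 ℕ.* n ℕ.+ 1) / suc (2 ℕ.* j) *_) (fromℕ-homo-* (n C j) ((2 ℕ.* n) C n)) ⟩
  (+ (2 ℕ.* n ℕ.+ 1) / suc (2 ℕ.* j)) * (fromℕ (n C j) * fromℕ ((2 ℕ.* n) C n)) ∎
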